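{- Let $\vec{u}$, $\vec{v}$ be disjoint lists of $n$ Boolean variables, let $\vec{a}$ be a list of auxiliary variables disjoint from them, and let $\mathcal{O}(\vec{u},\vec{v},\vec{a})$ and $\mathcal{S}(\vec{u},\vec{v},\vec{a})$ be PB formulas such that $\mathcal{S}$ is a specification over $\vec{a}$. Suppose that, for lists $\vec{x},\vec{y},\vec{w}$ of $n$ variables and auxiliary lists $\vec{a},\vec{b},\vec{c}$ (all pairwise disjoint), there are cutting planes proofs of $$\mathcal{S}(\vec{x},\vec{x},\vec{a})\vdash\mathcal{O}(\vec{x},\vec{x},\vec{a})$$ and $$\mathcal{S}(\vec{x},\vec{y},\vec{a})\cup\mathcal{O}(\vec{x},\vec{y},\vec{a})\cup\mathcal{S}(\vec{y},\vec{w},\vec{b})\cup\mathcal{O}(\vec{y},\vec{w},\vec{b})\cup\mathcal{S}(\vec{x},\vec{w},\vec{c})\vdash\mathcal{O}(\vec{x},\vec{w},\vec{c}).$$ Then the relation $\preceq$ defined by $\mathcal{O}$ and $\mathcal{S}$ is a preorder (reflexive and transitive).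
   Context: PB constraints: integer linear inequalities $\sum_i a_i\ell_i\ge A$ over literals (a literal is $x$ or $\bar x=1-x$); negation $\neg C\doteq\sum_i a_i\bar\ell_i\ge\sum_i a_i-A+1$; a PB formula is a finite set of PB constraints. A substitution $\omega$ maps variables to $\{0,1\}$ or literals, with $\omega(\bar x)=\overline{\omega(x)}$; $\mathrm{supp}(\omega)=\{x:\omega(x)\ne x\}$; $F\!\upharpoonright_\omega$ replaces each literal $\ell$ by $\omega(\ell)$. For a formula $F(\vec{x})$ written over a list $\vec{x}=x_1,\dots,x_n$ and a list $\vec{y}$ of literals/constants of the same length, $F(\vec{y})$ denotes $F\!\upharpoonright_\omega$ with $\omega(x_i)=y_i$; for a list $\vec{z}$ and assignment $\alpha$, $\vec{z}\!\upharpoonright_\alpha=\alpha(z_1),\dots,\alpha(z_n)$. $F\vdash G$ means each constraint of $G$ has a cutting planes derivation from $F$ (cutting planes is sound). A PB formula $\mathcal{S}(\vec{x},\vec{a})=\{C_1,\dots,C_m\}$ is a specification over $\vec{a}$ if there are substitutions $\omega_1,\dots,\omega_m$ with $\mathrm{supp}(\omega_i)\subseteq\vec{a}$ and $\{C_1,\dots,C_{i-1}\}\cup\{\neg C_i\}\vdash\{C_1,\dots,C_i\}\!\upharpoonright_{\omega_i}$ for each $i$. The relation defined by $\mathcal{O}$ and $\mathcal{S}$: fix a list $\vec{z}$ of $n$ variables disjoint from $\vec{a}$; for total assignments $\alpha,\beta$ to $\vec{z}$, $\alpha\preceq\beta$ holds iff there exists an assignment $\gamma$ to $\vec{a}$ such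 that $\mathcal{S}(\vec{z}\!\upharpoonright_\alpha,\vec{z}\!\upharpoonright_\beta,\vec{a}\!\upharpoonright_\gamma)\wedge\mathcal{O}(\vec{z}\!\upharpoonright_\alpha,\vec{z}\!\upharpoonright_\beta,\vec{a}\!\upharpoonright_\gamma)$ evaluates to true. -}

module Defs where

open import Data.Bool using (Bool; true; false; not)
open import Data.Empty using (⊥; ⊥-elim)
open import Data.Fin using (Fin; toℕ)
open import Data.Integer using (ℤ; +_; -_; _+_; _-_; _*_; _≥_; 0ℤ; 1ℤ)
open import Data.Integer.DivMod using (_/ℕ_)
open import Data.List using (List; []; _∷_; _++_; map; foldr; take; length; lookup)
open import Data.List.Membership.Propositional using (_∈_)
open import Data.List.Relation.Unary.All using (All)
open import Data.Nat using (ℕ; suc; NonZero)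
open import Data.Product using (Σ; _×_; _,_; ∃-syntax; proj₁)
open import Data.Sum using (_⊎_; inj₁; inj₂)
open import Relation.Binary.PropositionalEquality using (_≡_)

data Lit (V : Set) : Set where
  pos : V → Lit V
  neg : V → Lit V

negLit : {V : Set} → Lit V → Lit V
negLit (pos x) = neg x
negLit (neg x) = pos x

record Constraint (V : Set) : Set where
  constructor _≥ₚ_
  field
    terms  : List (ℤ × Lit V)
    degree : ℤ
open Constraint public

Formula : Set → Set
Formula V = List (Constraint V)

b2z : Bool → ℤ
b2z true  = 1ℤ
b2z false = 0ℤ

evalLit : {V : Set} → (V → Bool) → Lit V → ℤ
evalLit ρ (pos x) = b2z (ρ x)
evalLit ρ (neg x) = b2z (not (ρ x))

lhsValue : {V : Set} → (V → Bool) → List (ℤ × Lit V) → ℤ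
lhsValue ρ []             = 0ℤ
lhsValue ρ ((a , ℓ) ∷ ts) = a * evalLit ρ ℓ + lhsValue ρ ts

SatC : {V : Set} → (V → Bool) → Constraint V → Set
SatC ρ C = lhsValue ρ (terms C) ≥ degree C

Sat : {V : Set} → (V → Bool) → Formula V → Set
Sat ρ F = All (SatC ρ) F

Holds : Formula ⊥ → Set
Holds F = Sat ⊥-elim F

sumCoeffs : {V : Set} → List (ℤ × Lit V) → ℤ
sumCoeffs ts = foldr (λ t s → proj₁ t + s) 0ℤ ts

negC : {V : Set} → Constraint V → Constraint V
negC (ts ≥ₚ A) = map (λ { (a , ℓ) → (a , negLit ℓ) }) ts ≥ₚ (sumCoeffs ts - A + 1ℤ)

data Term (W : Set) : Set where
  const : Bool → Term W
  lit   : Lit W → Term W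

negTerm : {W : Set} → Term W → Term W
negTerm (const b) = const (not b)
negTerm (lit ℓ)   = lit (negLit ℓ)

Subst : Set → Set → Set
Subst V W = V → Term W

substLit : {V W : Set} → Subst V W → Lit V → Term W
substLit ω (pos x) = ω x
substLit ω (neg x) = negTerm (ω x)

-- F↾ω : replace each literal ℓ by ω(ℓ); constant contributions a·b are
-- moved to the right-hand side.
substTerms : {V W : Set} → Subst V W → List (ℤ × Lit V) → List (ℤ × Lit W) × ℤ
substTerms ω [] = [] , 0ℤ
substTerms ω ((a , ℓ) ∷ ts) with substLit ω ℓ | substTerms ω ts
... | const b | (us , k) = us , a * b2z b + k
... | lit ℓ′  | (us , k) = (a , ℓ′) ∷ us , k

substC : {V W : Set} → Subst V W → Constraint V → Constraint W
substC ω (ts ≥ₚ A) with substTerms ω ts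
... | (us , k) = us ≥ₚ (A - k)

_↾_ : {V W : Set} → Formula V → Subst V W → Formula W
F ↾ ω = map (substC ω) F

var : {W : Set} → W → Term W
var x = lit (pos x)

⌈_/_⌉ : ℤ → (c : ℕ) → .{{NonZero c}} → ℤ
⌈ a / c ⌉ = - ((- a) /ℕ c)

NonNeg : {V : Set} → ℤ × Lit V → Set
NonNeg (a , _) = a ≥ 0ℤ

-- C and D are the same linear inequality up to collecting like terms and
-- the identity x̄ = 1 - x.  (Two affine forms over Boolean variables are
-- syntactically equal after such normalisation iff they agree at every
-- 0/1 point.)
SameForm : {V : Set} → Constraint V → Constraint V → Set
SameForm {V} C D = ∀ (ρ : V → Bool) →
  lhsValue ρ (terms C) - degree C ≡ lhsValue ρ (terms D) - degree D

infix 4 _⊢c_ _⊢_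

data _⊢c_ {V : Set} (F : Formula V) : Constraint V → Set where
  axiom   : ∀ {C} → C ∈ F → F ⊢c C
  litAx   : ∀ ℓ → F ⊢c (((1ℤ , ℓ) ∷ []) ≥ₚ 0ℤ)
  addition : ∀ {C D} → F ⊢c C → F ⊢c D →
             F ⊢c ((terms C ++ terms D) ≥ₚ (degree C + degree D))
  multiply : ∀ {C} (c : ℕ) → .{{NonZero c}} → F ⊢c C →
             F ⊢c (map (λ { (a , ℓ) → (+ c * a , ℓ) }) (terms C) ≥ₚ (+ c * degree C))
  divide   : ∀ {C} (c : ℕ) → .{{_ : NonZero c}} → All NonNeg (terms C) → F ⊢c C →
             F ⊢c (map (λ { (a , ℓ) → (⌈ a / c ⌉ , ℓ) }) (terms C) ≥ₚ ⌈ degree C / c ⌉)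
  rewrite′ : ∀ {C D} → SameForm C D → F ⊢c C → F ⊢c D

_⊢_ : {V : Set} → Formula V → Formula V → Set
F ⊢ G = All (F ⊢c_) G

-- Formulas O(u⃗,v⃗,a⃗), S(u⃗,v⃗,a⃗):  variables are u⃗ (inj₁ (inj₁ i)),
-- v⃗ (inj₁ (inj₂ i)), i < n, and auxiliaries a⃗ (inj₂ j), j < m.

UVA : ℕ → ℕ → Set
UVA n m = (Fin n ⊎ Fin n) ⊎ Fin m

inst : {n m : ℕ} {W : Set} → Formula (UVA n m) →
       (Fin n → Term W) → (Fin n → Term W) → (Fin m → Term W) → Formula W
inst F y z c = F ↾ (λ { (inj₁ (inj₁ i)) → y i ; (inj₁ (inj₂ i)) → z i ; (inj₂ j) → c j })

-- Specification over the auxiliary variables (X ⊎ A, aux = A):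
-- S = C₁,…,C_m, and for each i a substitution ω_i with supp(ω_i) ⊆ a⃗ and
-- {C₁,…,C_{i-1}} ∪ {¬C_i} ⊢ {C₁,…,C_i}↾ω_i.
IsSpecification : {X A : Set} → Formula (X ⊎ A) → Set
IsSpecification {X} {A} S =
  ∀ (i : Fin (length S)) → ∃[ ω ]
    ((∀ (x : X) → ω (inj₁ x) ≡ var (inj₁ x)) ×
     (negC (lookup S i) ∷ take (toℕ i) S ⊢ take (suc (toℕ i)) S ↾ ω))

_≼[_,_]_ : {n m : ℕ} → (Fin n → Bool) → Formula (UVA n m) → Formula (UVA n m) →
           (Fin n → Bool) → Set
_≼[_,_]_ {n} {m} α O S β = Σ (Fin m → Bool) λ γ →
  (Holds (inst S (λ i → const (α i)) (λ i → const (β i)) (λ j → const {⊥} (γ j))) ×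
   Holds (inst O (λ i → const (α i)) (λ i → const (β i)) (λ j → const {⊥} (γ j))))

data Vars₁ (n m : ℕ) : Set where
  x₀ : Fin n → Vars₁ n m
  a₀ : Fin m → Vars₁ n m

data Vars₃ (n m : ℕ) : Set where
  x y w : Fin n → Vars₃ n m
  a b c : Fin m → Vars₃ n m

-- Cutting planes is sound for 0/1 assignments, so the two given derivations turn models of
-- their premises into models of their conclusions.  A witness for α ≼ α (resp. α ≼ δ) is
-- then any assignment γ of the auxiliary variables with S(α, α, γ) (resp. S(α, δ, γ)); the
-- instantiated derivation transfers O.  Such a γ always exists because S is a specification:
-- if an assignment satisfies C₁, …, Cᵢ₋₁ but violates Cᵢ, it satisfies the premises
-- ¬Cᵢ, C₁, …, Cᵢ₋₁ of the i-th specification proof, so composing it with ωᵢ gives a model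
-- of C₁, …, Cᵢ that differs only on auxiliary variables.  Repeating this for i = 1, …, m
-- satisfies all of S.
module Submission where

open import Defs
open import Data.Bool using (Bool; true; false; not)
open import Data.Bool.Properties using (not-involutive)
open import Data.Empty using (⊥; ⊥-elim)
open import Data.Fin using (Fin; toℕ; fromℕ<)
open import Data.Fin.Properties using (toℕ-fromℕ<)
open import Data.Integer using (ℤ; +_; -_; _+_; _-_; _*_; _≤_; _≤?_; 0ℤ; 1ℤ; -1ℤ; pred; +≤+)
  renaming (suc to sucℤ)
open import Data.Integer.DivMod using (_/ℕ_; [n/ℕd]*d≤n; n<s[n/ℕd]*d)
open import Data.Integer.Properties
open import Data.Integer.Tactic.RingSolver using (solve-∀)
open import Data.List using ([]; _∷_; _++_; map; take; length; lookup)
open import Data.List.Properties using (take-suc; take-all)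
open import Data.List.Relation.Unary.All as All using ([]; _∷_)
open import Data.List.Relation.Unary.All.Properties using (++⁺; map⁺; map⁻)
open import Data.Nat using (ℕ; zero; suc; NonZero; z≤n) renaming (_≤_ to _≤ℕ_)
open import Data.Nat.DivMod using (0/n≡0)
import Data.Nat.Properties as ℕ
open import Data.Product using (∃-syntax; _×_; _,_; proj₁; proj₂; map₁; map₂)
open import Data.Sum using (_⊎_; inj₁; inj₂)
open import Function using (_∘_)
open import Function.Bundles using (_⇔_; mk⇔; Equivalence)
open import Relation.Binary.PropositionalEquality
open import Relation.Binary.Structures using (IsPreorder)
open import Relation.Nullary using (¬_; yes; no)

open Equivalence using (to; from)

module _ (d : ℕ) .{{_ : NonZero d}} where

  /ℕ-greatest : ∀ {q i} → q * + d ≤ i → q ≤ i /ℕ d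
  /ℕ-greatest {q} {i} qd≤i = subst (q ≤_) (pred-suc (i /ℕ d))
    (i<j⇒i≤pred[j] (*-cancelʳ-<-nonNeg {j = sucℤ (i /ℕ d)} (+ d) (≤-<-trans qd≤i (n<s[n/ℕd]*d i d))))

  /ℕ-monoˡ-≤ : ∀ {i j} → i ≤ j → i /ℕ d ≤ j /ℕ d
  /ℕ-monoˡ-≤ {i} i≤j = /ℕ-greatest (≤-trans ([n/ℕd]*d≤n i d) i≤j)

  /ℕ-superadditive : ∀ i j → i /ℕ d + j /ℕ d ≤ (i + j) /ℕ d
  /ℕ-superadditive i j = /ℕ-greatest (begin
    (i /ℕ d + j /ℕ d) * + d        ≡⟨ *-distribʳ-+ (+ d) (i /ℕ d) (j /ℕ d) ⟩
    i /ℕ d * + d + j /ℕ d * + d    ≤⟨ +-mono-≤ ([n/ℕd]*d≤n i d) ([n/ℕd]*d≤n j d) ⟩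
    i + j                          ∎)
    where open ≤-Reasoning

  ⌈/⌉-mono-≤ : ∀ {i j} → i ≤ j → ⌈ i / d ⌉ ≤ ⌈ j / d ⌉
  ⌈/⌉-mono-≤ i≤j = neg-mono-≤ (/ℕ-monoˡ-≤ (neg-mono-≤ i≤j))

  ⌈+/⌉≤⌈/⌉+⌈/⌉ : ∀ i j → ⌈ i + j / d ⌉ ≤ ⌈ i / d ⌉ + ⌈ j / d ⌉
  ⌈+/⌉≤⌈/⌉+⌈/⌉ i j = begin
    - ((- (i + j)) /ℕ d)            ≡⟨ cong (λ k → - (k /ℕ d)) (neg-distrib-+ i j) ⟩
    - ((- i + - j) /ℕ d)            ≤⟨ neg-mono-≤ (/ℕ-superadditive (- i) (- j)) ⟩
    - ((- i) /ℕ d + (- j) /ℕ d)     ≡⟨ neg-distrib-+ ((- i) /ℕ d) ((- j) /ℕ d) ⟩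
    ⌈ i / d ⌉ + ⌈ j / d ⌉           ∎
    where open ≤-Reasoning

  ⌈0/⌉≡0 : ⌈ 0ℤ / d ⌉ ≡ 0ℤ
  ⌈0/⌉≡0 = cong (λ k → - (+ k)) (0/n≡0 d)

  ⌈*b2z/⌉≡⌈/⌉*b2z : ∀ i bit → ⌈ i * b2z bit / d ⌉ ≡ ⌈ i / d ⌉ * b2z bit
  ⌈*b2z/⌉≡⌈/⌉*b2z i true  = trans (cong ⌈_/ d ⌉ (*-identityʳ i)) (sym (*-identityʳ ⌈ i / d ⌉))
  ⌈*b2z/⌉≡⌈/⌉*b2z i false = trans (cong ⌈_/ d ⌉ (*-zeroʳ i)) (trans ⌈0/⌉≡0 (sym (*-zeroʳ ⌈ i / d ⌉)))

b2z-not : ∀ bit → b2z (not bit) ≡ 1ℤ - b2z bit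
b2z-not true  = refl
b2z-not false = refl

0≤b2z : ∀ bit → 0ℤ ≤ b2z bit
0≤b2z true  = +≤+ z≤n
0≤b2z false = +≤+ z≤n

module _ {V : Set} (ρ : V → Bool) where

  0≤evalLit : ∀ ℓ → 0ℤ ≤ evalLit ρ ℓ
  0≤evalLit (pos v) = 0≤b2z (ρ v)
  0≤evalLit (neg v) = 0≤b2z (not (ρ v))

  evalLit-negLit : ∀ ℓ → evalLit ρ (negLit ℓ) ≡ 1ℤ - evalLit ρ ℓ
  evalLit-negLit (pos v) = b2z-not (ρ v)
  evalLit-negLit (neg v) = trans (cong b2z (sym (not-involutive (ρ v)))) (b2z-not (not (ρ v)))

  lhsValue-++ : ∀ ts us → lhsValue ρ (ts ++ us) ≡ lhsValue ρ ts + lhsValue ρ us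
  lhsValue-++ []             us = sym (+-identityˡ (lhsValue ρ us))
  lhsValue-++ ((q , ℓ) ∷ ts) us = trans (cong (_+_ (q * evalLit ρ ℓ)) (lhsValue-++ ts us))
                                        (sym (+-assoc (q * evalLit ρ ℓ) (lhsValue ρ ts) (lhsValue ρ us)))

  lhsValue-scale : ∀ r ts → lhsValue ρ (map (map₁ (r *_)) ts) ≡ r * lhsValue ρ ts
  lhsValue-scale r []             = sym (*-zeroʳ r)
  lhsValue-scale r ((q , ℓ) ∷ ts) =
    trans (cong (_+_ (r * q * evalLit ρ ℓ)) (lhsValue-scale r ts))
          (distribute r q (evalLit ρ ℓ) (lhsValue ρ ts))
    where
    distribute : ∀ r q e l → r * q * e + r * l ≡ r * (q * e + l)
    distribute = solve-∀

  lhsValue-negLits : ∀ ts → lhsValue ρ (map (map₂ negLit) ts) ≡ sumCoeffs ts - lhsValue ρ ts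
  lhsValue-negLits []             = refl
  lhsValue-negLits ((q , ℓ) ∷ ts) =
    trans (cong₂ _+_ (cong (q *_) (evalLit-negLit ℓ)) (lhsValue-negLits ts))
          (regroup q (evalLit ρ ℓ) (sumCoeffs ts) (lhsValue ρ ts))
    where
    regroup : ∀ q e s l → q * (1ℤ - e) + (s - l) ≡ (q + s) - (q * e + l)
    regroup = solve-∀

  ⌈lhsValue/⌉≤lhsValue-⌈/⌉ : ∀ (k : ℕ) .{{_ : NonZero k}} ts →
                             ⌈ lhsValue ρ ts / k ⌉ ≤ lhsValue ρ (map (map₁ ⌈_/ k ⌉) ts)
  ⌈lhsValue/⌉≤lhsValue-⌈/⌉ k []             = ≤-reflexive (⌈0/⌉≡0 k)
  ⌈lhsValue/⌉≤lhsValue-⌈/⌉ k ((q , ℓ) ∷ ts) = begin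
    ⌈ q * evalLit ρ ℓ + lhsValue ρ ts / k ⌉          ≤⟨ ⌈+/⌉≤⌈/⌉+⌈/⌉ k (q * evalLit ρ ℓ) (lhsValue ρ ts) ⟩
    ⌈ q * evalLit ρ ℓ / k ⌉ + ⌈ lhsValue ρ ts / k ⌉  ≤⟨ +-mono-≤ (≤-reflexive (⌈*evalLit/⌉ ℓ))
                                                                 (⌈lhsValue/⌉≤lhsValue-⌈/⌉ k ts) ⟩
    ⌈ q / k ⌉ * evalLit ρ ℓ + lhsValue ρ (map (map₁ ⌈_/ k ⌉) ts) ∎
    where
    open ≤-Reasoning
    ⌈*evalLit/⌉ : ∀ ℓ → ⌈ q * evalLit ρ ℓ / k ⌉ ≡ ⌈ q / k ⌉ * evalLit ρ ℓ
    ⌈*evalLit/⌉ (pos v) = ⌈*b2z/⌉≡⌈/⌉*b2z k q (ρ v)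
    ⌈*evalLit/⌉ (neg v) = ⌈*b2z/⌉≡⌈/⌉*b2z k q (not (ρ v))

  SatC-negC : ∀ {C} → ¬ SatC ρ C → SatC ρ (negC C)
  SatC-negC {ts ≥ₚ A} ⊭C = begin
    sumCoeffs ts - A + 1ℤ              ≡⟨ regroup (sumCoeffs ts) A ⟩
    sumCoeffs ts - pred A              ≤⟨ +-monoʳ-≤ (sumCoeffs ts) (neg-mono-≤ (i<j⇒i≤pred[j] (≰⇒> ⊭C))) ⟩
    sumCoeffs ts - lhsValue ρ ts       ≡⟨ lhsValue-negLits ts ⟨
    lhsValue ρ (map (map₂ negLit) ts)  ∎
    where
    open ≤-Reasoning
    regroup : ∀ s a → s - a + 1ℤ ≡ s - (-1ℤ + a)
    regroup = solve-∀

slack : {V : Set} → (V → Bool) → Constraint V → ℤ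
slack ρ C = lhsValue ρ (terms C) - degree C

SatC-resp-slack : ∀ {V W : Set} (ρ : V → Bool) (σ : W → Bool) C D →
                  slack ρ C ≡ slack σ D → SatC ρ C → SatC σ D
SatC-resp-slack _ _ _ _ slack≡ ⊨C = 0≤i-j⇒j≤i (subst (0ℤ ≤_) slack≡ (i≤j⇒0≤j-i ⊨C))

module _ {V : Set} (ρ : V → Bool) where

  ⊢c-sound : ∀ {F C} → Sat ρ F → F ⊢c C → SatC ρ C
  ⊢c-sound ⊨F (axiom C∈F) = All.lookup ⊨F C∈F
  ⊢c-sound ⊨F (litAx ℓ) =
    subst (0ℤ ≤_) (sym (trans (+-identityʳ (1ℤ * evalLit ρ ℓ)) (*-identityˡ (evalLit ρ ℓ))))
      (0≤evalLit ρ ℓ)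
  ⊢c-sound ⊨F (addition {C} {D} ⊢C ⊢D) =
    subst (degree C + degree D ≤_) (sym (lhsValue-++ ρ (terms C) (terms D)))
      (+-mono-≤ (⊢c-sound ⊨F ⊢C) (⊢c-sound ⊨F ⊢D))
  ⊢c-sound ⊨F (multiply {C} k ⊢C) =
    subst (+ k * degree C ≤_) (sym (lhsValue-scale ρ (+ k) (terms C)))
      (*-monoˡ-≤-nonNeg (+ k) (⊢c-sound ⊨F ⊢C))
  ⊢c-sound ⊨F (divide {C} k _ ⊢C) =
    ≤-trans (⌈/⌉-mono-≤ k (⊢c-sound ⊨F ⊢C)) (⌈lhsValue/⌉≤lhsValue-⌈/⌉ ρ k (terms C))
  ⊢c-sound ⊨F (rewrite′ {C} {D} sameForm ⊢C) =
    SatC-resp-slack ρ ρ C D (sameForm ρ) (⊢c-sound ⊨F ⊢C)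

  ⊢-sound : ∀ {F G} → Sat ρ F → F ⊢ G → Sat ρ G
  ⊢-sound ⊨F = All.map (⊢c-sound ⊨F)

evalTerm : {W : Set} → (W → Bool) → Term W → Bool
evalTerm ρ (const bit)   = bit
evalTerm ρ (lit (pos v)) = ρ v
evalTerm ρ (lit (neg v)) = not (ρ v)

evalTerm-negTerm : {W : Set} (ρ : W → Bool) (t : Term W) → evalTerm ρ (negTerm t) ≡ not (evalTerm ρ t)
evalTerm-negTerm ρ (const bit)   = refl
evalTerm-negTerm ρ (lit (pos v)) = refl
evalTerm-negTerm ρ (lit (neg v)) = sym (not-involutive (ρ v))

module _ {V W : Set} (ω : Subst V W) (ρ : W → Bool) where

  b2z-evalTerm-substLit : ∀ ℓ → b2z (evalTerm ρ (substLit ω ℓ)) ≡ evalLit (evalTerm ρ ∘ ω) ℓ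
  b2z-evalTerm-substLit (pos v) = refl
  b2z-evalTerm-substLit (neg v) = cong b2z (evalTerm-negTerm ρ (ω v))

  lhsValue-substTerms : ∀ ts → lhsValue (evalTerm ρ ∘ ω) ts
                             ≡ lhsValue ρ (proj₁ (substTerms ω ts)) + proj₂ (substTerms ω ts)
  lhsValue-substTerms [] = refl
  lhsValue-substTerms ((q , ℓ) ∷ ts)
    with substLit ω ℓ | b2z-evalTerm-substLit ℓ | substTerms ω ts | lhsValue-substTerms ts
  ... | const bit   | value≡ | us , k | ih rewrite sym value≡ | ih = swap (q * b2z bit) (lhsValue ρ us) k
    where
    swap : ∀ p l k → p + (l + k) ≡ l + (p + k)
    swap = solve-∀
  ... | lit (pos v) | value≡ | us , k | ih rewrite sym value≡ | ih =
    sym (+-assoc (q * b2z (ρ v)) (lhsValue ρ us) k)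
  ... | lit (neg v) | value≡ | us , k | ih rewrite sym value≡ | ih =
    sym (+-assoc (q * b2z (not (ρ v))) (lhsValue ρ us) k)

  slack-substC : ∀ C → slack ρ (substC ω C) ≡ slack (evalTerm ρ ∘ ω) C
  slack-substC (ts ≥ₚ A) with substTerms ω ts | lhsValue-substTerms ts
  ... | us , k | lhs≡ = trans (regroup (lhsValue ρ us) A k) (cong (_- A) (sym lhs≡))
    where
    regroup : ∀ l a k → l - (a - k) ≡ l + k - a
    regroup = solve-∀

  Sat-↾ : ∀ F → Sat ρ (F ↾ ω) ⇔ Sat (evalTerm ρ ∘ ω) F
  Sat-↾ F = mk⇔
    (All.map (λ {C} → SatC-resp-slack ρ (evalTerm ρ ∘ ω) (substC ω C) C (slack-substC C)) ∘ map⁻)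
    (map⁺ ∘ All.map (λ {C} → SatC-resp-slack (evalTerm ρ ∘ ω) ρ C (substC ω C) (sym (slack-substC C))))

Sat-cong : ∀ {V : Set} {ρ σ : V → Bool} → ρ ≗ σ → ∀ F → Sat ρ F → Sat σ F
Sat-cong {ρ = ρ} {σ} ρ≗σ F = All.map (λ {C} → subst (degree C ≤_) (lhsValue-cong (terms C)))
  where
  evalLit-cong : ∀ ℓ → evalLit ρ ℓ ≡ evalLit σ ℓ
  evalLit-cong (pos v) = cong b2z (ρ≗σ v)
  evalLit-cong (neg v) = cong (b2z ∘ not) (ρ≗σ v)
  lhsValue-cong : ∀ ts → lhsValue ρ ts ≡ lhsValue σ ts
  lhsValue-cong []             = refl
  lhsValue-cong ((q , ℓ) ∷ ts) = cong₂ _+_ (cong (q *_) (evalLit-cong ℓ)) (lhsValue-cong ts)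

Extension : {X A : Set} → (X ⊎ A → Bool) → Formula (X ⊎ A) → Set
Extension ρ F = ∃[ σ ] (σ ∘ inj₁ ≗ ρ ∘ inj₁) × Sat σ F

module _ {X A : Set} (S : Formula (X ⊎ A)) (spec : IsSpecification S) (ρ : X ⊎ A → Bool) where

  Extension-take-suc : ∀ i → Extension ρ (take (toℕ i) S) → Extension ρ (take (suc (toℕ i)) S)
  Extension-take-suc i (σ , σ≗ρ , ⊨prefix)
    with degree (lookup S i) ≤? lhsValue σ (terms (lookup S i)) | spec i
  ... | yes ⊨Cᵢ | _ = σ , σ≗ρ , subst (Sat σ) (sym (take-suc S i)) (++⁺ ⊨prefix (⊨Cᵢ ∷ []))
  ... | no ⊭Cᵢ | ω , ω-fixes-X , ⊢prefix↾ω =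
    evalTerm σ ∘ ω ,
    (λ u → trans (cong (evalTerm σ) (ω-fixes-X u)) (σ≗ρ u)) ,
    to (Sat-↾ ω σ _) (⊢-sound σ (SatC-negC σ {lookup S i} ⊭Cᵢ ∷ ⊨prefix) ⊢prefix↾ω)

  Extension-take : ∀ k → k ≤ℕ length S → Extension ρ (take k S)
  Extension-take zero    _     = ρ , (λ _ → refl) , []
  Extension-take (suc k) k<∣S∣ =
    step (fromℕ< k<∣S∣) (toℕ-fromℕ< k<∣S∣) (Extension-take k (ℕ.<⇒≤ k<∣S∣))
    where
    step : ∀ {j} (i : Fin (length S)) → toℕ i ≡ j → Extension ρ (take j S) → Extension ρ (take (suc j) S)
    step i refl = Extension-take-suc i

  IsSpecification⇒Extension : Extension ρ S
  IsSpecification⇒Extension =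
    subst (Extension ρ) (take-all (length S) S ℕ.≤-refl) (Extension-take (length S) ℕ.≤-refl)

⟨_,_,_⟩ : {n m : ℕ} → (Fin n → Bool) → (Fin n → Bool) → (Fin m → Bool) → UVA n m → Bool
⟨ α , β , γ ⟩ (inj₁ (inj₁ i)) = α i
⟨ α , β , γ ⟩ (inj₁ (inj₂ i)) = β i
⟨ α , β , γ ⟩ (inj₂ j)        = γ j

module _ {n m : ℕ} (F : Formula (UVA n m)) where

  Sat-inst : ∀ {W : Set} (ρ : W → Bool) ys zs cs →
             Sat ρ (inst F ys zs cs) ⇔ Sat ⟨ evalTerm ρ ∘ ys , evalTerm ρ ∘ zs , evalTerm ρ ∘ cs ⟩ F
  Sat-inst ρ ys zs cs = mk⇔
    (Sat-cong (λ { (inj₁ (inj₁ i)) → refl ; (inj₁ (inj₂ i)) → refl ; (inj₂ j) → refl }) F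
      ∘ to (Sat-↾ _ ρ F))
    (from (Sat-↾ _ ρ F)
      ∘ Sat-cong (λ { (inj₁ (inj₁ i)) → refl ; (inj₁ (inj₂ i)) → refl ; (inj₂ j) → refl }) F)

  Sat-inst-var : ∀ {W : Set} (ρ : W → Bool) (f g : Fin n → W) (h : Fin m → W) →
                 Sat ρ (inst F (var ∘ f) (var ∘ g) (var ∘ h)) ⇔ Sat ⟨ ρ ∘ f , ρ ∘ g , ρ ∘ h ⟩ F
  Sat-inst-var ρ f g h = Sat-inst ρ (var ∘ f) (var ∘ g) (var ∘ h)

  Holds-inst-const : ∀ α β γ →
    Holds (inst F (λ i → const (α i)) (λ i → const (β i)) (λ j → const {⊥} (γ j))) ⇔ Sat ⟨ α , β , γ ⟩ F
  Holds-inst-const α β γ = Sat-inst ⊥-elim (const ∘ α) (const ∘ β) (const ∘ γ)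

IsSpecification⇒∃-auxiliary : ∀ {n m} (S : Formula (UVA n m)) → IsSpecification S →
                              ∀ α β → ∃[ γ ] Sat ⟨ α , β , γ ⟩ S
IsSpecification⇒∃-auxiliary S spec α β with IsSpecification⇒Extension S spec ⟨ α , β , (λ _ → false) ⟩
... | σ , σ≗ , ⊨S = σ ∘ inj₂ , Sat-cong agree S ⊨S
  where
  agree : σ ≗ ⟨ α , β , σ ∘ inj₂ ⟩
  agree (inj₁ (inj₁ i)) = σ≗ (inj₁ i)
  agree (inj₁ (inj₂ i)) = σ≗ (inj₂ i)
  agree (inj₂ j)        = refl

≼-intro : ∀ {n m} (O S : Formula (UVA n m)) {α β} γ →
          Sat ⟨ α , β , γ ⟩ S → Sat ⟨ α , β , γ ⟩ O → α ≼[ O , S ] β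
≼-intro O S {α} {β} γ ⊨S ⊨O = γ , from (Holds-inst-const S α β γ) ⊨S , from (Holds-inst-const O α β γ) ⊨O

lemma2 : (n m : ℕ) (O S : Formula (UVA n m)) →
         IsSpecification S →
         inst S (λ i → var (x₀ i)) (λ i → var (x₀ i)) (λ j → var (a₀ j))
           ⊢ inst O (λ i → var (x₀ i)) (λ i → var (x₀ i)) (λ j → var (a₀ j)) →
         (inst S (λ i → var (x i)) (λ i → var (y i)) (λ j → var (a j))
            ++ inst O (λ i → var (x i)) (λ i → var (y i)) (λ j → var (a j))
            ++ inst S (λ i → var (y i)) (λ i → var (w i)) (λ j → var (b j))
            ++ inst O (λ i → var (y i)) (λ i → var (w i)) (λ j → var (b j))
            ++ inst S (λ i → var (x i)) (λ i → var (w i)) (λ j → var (c j)))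
           ⊢ inst O (λ i → var (x i)) (λ i → var (w i)) (λ j → var (c j)) →
         IsPreorder (_≡_ {A = Fin n → Bool}) (λ α β → α ≼[ O , S ] β)
lemma2 n m O S spec ⊢O-refl ⊢O-trans = record
  { isEquivalence = isEquivalence
  ; reflexive     = λ { {α} refl → ≼-refl α }
  ; trans         = ≼-trans
  }
  where
  ≼-refl : ∀ α → α ≼[ O , S ] α
  ≼-refl α with IsSpecification⇒∃-auxiliary S spec α α
  ... | γ , ⊨S = ≼-intro O S γ ⊨S
    (to (Sat-inst-var O ρ x₀ x₀ a₀) (⊢-sound ρ (from (Sat-inst-var S ρ x₀ x₀ a₀) ⊨S) ⊢O-refl))
    where
    ρ : Vars₁ n m → Bool
    ρ (x₀ i) = α i
    ρ (a₀ j) = γ j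

  ≼-trans : ∀ {α β δ} → α ≼[ O , S ] β → β ≼[ O , S ] δ → α ≼[ O , S ] δ
  ≼-trans {α} {β} {δ} (γ₁ , ⊨S₁ , ⊨O₁) (γ₂ , ⊨S₂ , ⊨O₂)
    with IsSpecification⇒∃-auxiliary S spec α δ
  ... | γ₃ , ⊨S₃ = ≼-intro O S γ₃ ⊨S₃ (to (Sat-inst-var O ρ x w c) (⊢-sound ρ
      (++⁺ (from (Sat-inst-var S ρ x y a) (to (Holds-inst-const S α β γ₁) ⊨S₁))
      (++⁺ (from (Sat-inst-var O ρ x y a) (to (Holds-inst-const O α β γ₁) ⊨O₁))
      (++⁺ (from (Sat-inst-var S ρ y w b) (to (Holds-inst-const S β δ γ₂) ⊨S₂))
      (++⁺ (from (Sat-inst-var O ρ y w b) (to (Holds-inst-const O β δ γ₂) ⊨O₂))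
           (from (Sat-inst-var S ρ x w c) ⊨S₃)))))
      ⊢O-trans))
    where
    ρ : Vars₃ n m → Bool
    ρ (x i) = α i
    ρ (y i) = β i
    ρ (w i) = δ i
    ρ (a j) = γ₁ j
    ρ (b j) = γ₂ j
    ρ (c j) = γ₃ j
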